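{- Let $\mathcal{C}$ be a suitable model category and $\mathcal{C}_{fb}$ its full subcategory of fibrant objects. Then $\mathcal{C}_{fb}$ is bicartesian closed (has finite products, finite coproducts and exponentials) and the inclusion functor $\mathcal{C}_{fb}\hookrightarrow\mathcal{C}$ is bicartesian closed (preserves finite products, finite coproducts and exponential diagrams).
   Context: A model category $\mathcal{C}$ is suitable if (i) it is right proper (weak equivalences are stable under pullback along fibrations); (ii) its cofibrations are exactly its monomorphisms; (iii) $[f,g]:A+B\to C$ is a fibration whenever $f:A\to C$ and $g:B\to C$ are, and the unique morphism $0\to A$ is always a fibration; (iv) as a category it is locally cartesian closed (has a terminal object and every slice is cartesian closed). -}

module Defs where

open import Level using (Level; _⊔_) renaming (suc to lsuc)
open import Data.Product using (Σ; Σ-syntax; _×_; _,_; proj₁; proj₂)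
open import Relation.Binary.PropositionalEquality using (_≡_; refl; cong)

record Category (o ℓ : Level) : Set (lsuc (o ⊔ ℓ)) where
  infixr 9 _∘_
  field
    Obj       : Set o
    Hom       : Obj → Obj → Set ℓ
    id        : ∀ {A} → Hom A A
    _∘_       : ∀ {A B C} → Hom B C → Hom A B → Hom A C
    identityˡ : ∀ {A B} {f : Hom A B} → id ∘ f ≡ f
    identityʳ : ∀ {A B} {f : Hom A B} → f ∘ id ≡ f
    assoc     : ∀ {A B C D} {f : Hom A B} {g : Hom B C} {h : Hom C D} →
                (h ∘ g) ∘ f ≡ h ∘ (g ∘ f)

∃!≡ : ∀ {a b} {A : Set a} → (A → Set b) → Set (a ⊔ b)
∃!≡ {A = A} P = Σ[ x ∈ A ] (P x × (∀ (y : A) → P y → y ≡ x))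

module Constructions {o ℓ : Level} (𝒞 : Category o ℓ) where
  open Category 𝒞

  IsTerminal : Obj → Set (o ⊔ ℓ)
  IsTerminal T = ∀ (X : Obj) → Σ[ h ∈ Hom X T ] (∀ (g : Hom X T) → g ≡ h)

  IsInitial : Obj → Set (o ⊔ ℓ)
  IsInitial I = ∀ (X : Obj) → Σ[ h ∈ Hom I X ] (∀ (g : Hom I X) → g ≡ h)

  IsProduct : ∀ {A B P} → Hom P A → Hom P B → Set (o ⊔ ℓ)
  IsProduct {A} {B} {P} π₁ π₂ =
    ∀ {X : Obj} (f : Hom X A) (g : Hom X B) →
      ∃!≡ (λ (h : Hom X P) → (π₁ ∘ h ≡ f) × (π₂ ∘ h ≡ g))

  IsCoproduct : ∀ {A B S} → Hom A S → Hom B S → Set (o ⊔ ℓ)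
  IsCoproduct {A} {B} {S} i₁ i₂ =
    ∀ {X : Obj} (f : Hom A X) (g : Hom B X) →
      ∃!≡ (λ (h : Hom S X) → (h ∘ i₁ ≡ f) × (h ∘ i₂ ≡ g))

  copair : ∀ {A B S X} {i₁ : Hom A S} {i₂ : Hom B S} →
           IsCoproduct i₁ i₂ → Hom A X → Hom B X → Hom S X
  copair cp f g = proj₁ (cp f g)

  IsPullback : ∀ {A B C P} → Hom A C → Hom B C → Hom P A → Hom P B → Set (o ⊔ ℓ)
  IsPullback {A} {B} {C} {P} f g p₁ p₂ =
    (f ∘ p₁ ≡ g ∘ p₂) ×
    (∀ {X : Obj} (h : Hom X A) (k : Hom X B) → f ∘ h ≡ g ∘ k →
       ∃!≡ (λ (u : Hom X P) → (p₁ ∘ u ≡ h) × (p₂ ∘ u ≡ k)))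

  IsPushout : ∀ {A B C Q} → Hom C A → Hom C B → Hom A Q → Hom B Q → Set (o ⊔ ℓ)
  IsPushout {A} {B} {C} {Q} f g q₁ q₂ =
    (q₁ ∘ f ≡ q₂ ∘ g) ×
    (∀ {X : Obj} (h : Hom A X) (k : Hom B X) → h ∘ f ≡ k ∘ g →
       ∃!≡ (λ (u : Hom Q X) → (u ∘ q₁ ≡ h) × (u ∘ q₂ ≡ k)))

  Mono : ∀ {A B} → Hom A B → Set (o ⊔ ℓ)
  Mono {A} f = ∀ {X : Obj} (g h : Hom X A) → f ∘ g ≡ f ∘ h → g ≡ h

  -- For every product (Q, q₁, q₂) of X and A and every
  -- f : Q → B there is a unique g : X → E with ev ∘ (g × id_A) = f.
  record IsExponential {A B E P : Obj}
                       (π₁ : Hom P E) (π₂ : Hom P A) (ev : Hom P B) : Set (o ⊔ ℓ) where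
    field
      isProduct : IsProduct π₁ π₂
      curry-unique :
        ∀ {X Q : Obj} (q₁ : Hom Q X) (q₂ : Hom Q A) → IsProduct q₁ q₂ →
        (f : Hom Q B) →
        ∃!≡ (λ (g : Hom X E) → ev ∘ proj₁ (isProduct (g ∘ q₁) q₂) ≡ f)

  HasTerminal : Set (o ⊔ ℓ)
  HasTerminal = Σ[ T ∈ Obj ] IsTerminal T

  HasInitial : Set (o ⊔ ℓ)
  HasInitial = Σ[ I ∈ Obj ] IsInitial I

  HasBinaryProducts : Set (o ⊔ ℓ)
  HasBinaryProducts = ∀ (A B : Obj) →
    Σ[ P ∈ Obj ] Σ[ π₁ ∈ Hom P A ] Σ[ π₂ ∈ Hom P B ] IsProduct π₁ π₂

  HasBinaryCoproducts : Set (o ⊔ ℓ)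
  HasBinaryCoproducts = ∀ (A B : Obj) →
    Σ[ S ∈ Obj ] Σ[ i₁ ∈ Hom A S ] Σ[ i₂ ∈ Hom B S ] IsCoproduct i₁ i₂

  HasPullbacks : Set (o ⊔ ℓ)
  HasPullbacks = ∀ {A B C : Obj} (f : Hom A C) (g : Hom B C) →
    Σ[ P ∈ Obj ] Σ[ p₁ ∈ Hom P A ] Σ[ p₂ ∈ Hom P B ] IsPullback f g p₁ p₂

  HasPushouts : Set (o ⊔ ℓ)
  HasPushouts = ∀ {A B C : Obj} (f : Hom C A) (g : Hom C B) →
    Σ[ Q ∈ Obj ] Σ[ q₁ ∈ Hom A Q ] Σ[ q₂ ∈ Hom B Q ] IsPushout f g q₁ q₂

  HasExponentials : Set (o ⊔ ℓ)
  HasExponentials = ∀ (A B : Obj) →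
    Σ[ E ∈ Obj ] Σ[ P ∈ Obj ] Σ[ π₁ ∈ Hom P E ] Σ[ π₂ ∈ Hom P A ] Σ[ ev ∈ Hom P B ]
      IsExponential π₁ π₂ ev

  record FinitelyComplete : Set (o ⊔ ℓ) where
    field
      terminal : HasTerminal
      pullback : HasPullbacks

  record FinitelyCocomplete : Set (o ⊔ ℓ) where
    field
      initial  : HasInitial
      pushout  : HasPushouts

  record CartesianClosed : Set (o ⊔ ℓ) where
    field
      terminal     : HasTerminal
      products     : HasBinaryProducts
      exponentials : HasExponentials

  record BicartesianClosed : Set (o ⊔ ℓ) where
    field
      terminal     : HasTerminal
      products     : HasBinaryProducts
      initial      : HasInitial
      coproducts   : HasBinaryCoproducts
      exponentials : HasExponentials

module _ {o ℓ : Level} (𝒞 : Category o ℓ) where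
  open Category 𝒞

  record SliceHom (X : Obj) (a b : Σ[ A ∈ Obj ] Hom A X) : Set ℓ where
    constructor sliceHom
    field
      hom   : Hom (proj₁ a) (proj₁ b)
      .comm : proj₂ b ∘ hom ≡ proj₂ a

  private
    sliceHom-≡ : ∀ {X a b} {f g : SliceHom X a b} →
                 SliceHom.hom f ≡ SliceHom.hom g → f ≡ g
    sliceHom-≡ {f = sliceHom h _} {g = sliceHom .h _} refl = refl

  Slice : Obj → Category (o ⊔ ℓ) ℓ
  Slice X = record
    { Obj       = Σ[ A ∈ Obj ] Hom A X
    ; Hom       = SliceHom X
    ; id        = sliceHom id identityʳ
    ; _∘_       = λ { (sliceHom g gc) (sliceHom f fc) →
                      sliceHom (g ∘ f) (trans′ (sym′ assoc) (trans′ (cong (_∘ f) gc) fc)) }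
    ; identityˡ = sliceHom-≡ identityˡ
    ; identityʳ = sliceHom-≡ identityʳ
    ; assoc     = sliceHom-≡ assoc
    }
    where
      open import Relation.Binary.PropositionalEquality
        using () renaming (trans to trans′; sym to sym′)

  LocallyCartesianClosed : Set (o ⊔ ℓ)
  LocallyCartesianClosed =
    Constructions.HasTerminal 𝒞 × (∀ (X : Obj) → Constructions.CartesianClosed (Slice X))

-- Model categories (Riehl, Categorical Homotopy Theory, Def. 11.3.1):
-- a category with finite limits and colimits with classes W, C, F such
-- that W satisfies 2-out-of-3 and (C ∩ W, F) and (C, F ∩ W) are weak
-- factorization systems (L = ⧄R, R = L⧄, and every map factors as R ∘ L).

module _ {o ℓ : Level} (𝒞 : Category o ℓ) where
  open Category 𝒞

  _⧄_ : ∀ {A B X Y} → Hom A B → Hom X Y → Set ℓ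
  _⧄_ {A} {B} {X} {Y} i p =
    ∀ (u : Hom A X) (v : Hom B Y) → p ∘ u ≡ v ∘ i →
      Σ[ d ∈ Hom B X ] ((d ∘ i ≡ u) × (p ∘ d ≡ v))

  MorClass : (p : Level) → Set (o ⊔ ℓ ⊔ lsuc p)
  MorClass p = ∀ {A B : Obj} → Hom A B → Set p

  _∩_ : ∀ {p} → MorClass p → MorClass p → MorClass p
  (P ∩ Q) f = P f × Q f

  record IsWFS {p} (L R : MorClass p) : Set (o ⊔ ℓ ⊔ p) where
    field
      factor : ∀ {A B} (f : Hom A B) →
               Σ[ M ∈ Obj ] Σ[ l ∈ Hom A M ] Σ[ r ∈ Hom M B ] (L l × R r × (r ∘ l ≡ f))
      L⇒⧄R  : ∀ {A B} {l : Hom A B} → L l → ∀ {X Y} {r : Hom X Y} → R r → l ⧄ r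
      ⧄R⇒L  : ∀ {A B} {l : Hom A B} → (∀ {X Y} {r : Hom X Y} → R r → l ⧄ r) → L l
      L⧄⇒R  : ∀ {X Y} {r : Hom X Y} → (∀ {A B} {l : Hom A B} → L l → l ⧄ r) → R r

  record ModelCategory (p : Level) : Set (o ⊔ ℓ ⊔ lsuc p) where
    field
      W C F : MorClass p
      finitelyComplete   : Constructions.FinitelyComplete 𝒞
      finitelyCocomplete : Constructions.FinitelyCocomplete 𝒞
      2-out-of-3-∘  : ∀ {A B D} {f : Hom A B} {g : Hom B D} → W f → W g → W (g ∘ f)
      2-out-of-3-l  : ∀ {A B D} {f : Hom A B} {g : Hom B D} → W g → W (g ∘ f) → W f
      2-out-of-3-r  : ∀ {A B D} {f : Hom A B} {g : Hom B D} → W f → W (g ∘ f) → W g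
      trivCof-fib   : IsWFS (C ∩ W) F
      cof-trivFib   : IsWFS C (F ∩ W)

    𝟙 : Obj
    𝟙 = proj₁ (Constructions.FinitelyComplete.terminal finitelyComplete)

    ! : ∀ (A : Obj) → Hom A 𝟙
    ! A = proj₁ (proj₂ (Constructions.FinitelyComplete.terminal finitelyComplete) A)

    Fibrant : Obj → Set p
    Fibrant A = F (! A)

  record Suitable {p} (M : ModelCategory p) : Set (o ⊔ ℓ ⊔ p) where
    open ModelCategory M
    open Constructions 𝒞
    field
      rightProper : ∀ {A B D P} (f : Hom A D) (g : Hom B D)
                      (p₁ : Hom P A) (p₂ : Hom P B) →
                    IsPullback f g p₁ p₂ → W f → F g → W p₂
      cof⇒mono : ∀ {A B} {f : Hom A B} → C f → Mono f
      mono⇒cof : ∀ {A B} {f : Hom A B} → Mono f → C f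
      copair-fib : ∀ {A B S D} {i₁ : Hom A S} {i₂ : Hom B S}
                     (cp : IsCoproduct i₁ i₂) {f : Hom A D} {g : Hom B D} →
                   F f → F g → F (copair cp f g)
      initial-fib : ∀ {Z} (z : IsInitial Z) (A : Obj) → F (proj₁ (z A))
      lcc : LocallyCartesianClosed 𝒞

module _ {o ℓ p : Level} {𝒞 : Category o ℓ} (M : ModelCategory 𝒞 p) where
  open Category 𝒞
  open ModelCategory M

  Fib : Category (o ⊔ p) ℓ
  Fib = record
    { Obj       = Σ[ A ∈ Obj ] Fibrant A
    ; Hom       = λ A B → Hom (proj₁ A) (proj₁ B)
    ; id        = id
    ; _∘_       = _∘_
    ; identityˡ = identityˡ
    ; identityʳ = identityʳ
    ; assoc     = assoc
    }

  -- The inclusion Fib ↪ 𝒞 (proj₁ on objects, identity on morphisms)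
  -- preserves terminal objects, binary products, initial objects,
  -- binary coproducts and exponential diagrams.
  record InclusionBicartesianClosed : Set (o ⊔ ℓ ⊔ p) where
    private
      module F = Constructions Fib
      module C = Constructions 𝒞
    field
      pres-terminal : ∀ (T : Category.Obj Fib) → F.IsTerminal T → C.IsTerminal (proj₁ T)
      pres-initial  : ∀ (I : Category.Obj Fib) → F.IsInitial I → C.IsInitial (proj₁ I)
      pres-product  : ∀ {A B P : Category.Obj Fib}
                        (π₁ : Category.Hom Fib P A) (π₂ : Category.Hom Fib P B) →
                      F.IsProduct {A} {B} {P} π₁ π₂ →
                      C.IsProduct {proj₁ A} {proj₁ B} {proj₁ P} π₁ π₂
      pres-coproduct : ∀ {A B S : Category.Obj Fib}
                        (i₁ : Category.Hom Fib A S) (i₂ : Category.Hom Fib B S) →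
                      F.IsCoproduct {A} {B} {S} i₁ i₂ →
                      C.IsCoproduct {proj₁ A} {proj₁ B} {proj₁ S} i₁ i₂
      pres-exponential : ∀ {A B E P : Category.Obj Fib}
                        (π₁ : Category.Hom Fib P E) (π₂ : Category.Hom Fib P A)
                        (ev : Category.Hom Fib P B) →
                      F.IsExponential {A} {B} {E} {P} π₁ π₂ ev →
                      C.IsExponential {proj₁ A} {proj₁ B} {proj₁ E} {proj₁ P} π₁ π₂ ev

{-# OPTIONS --safe #-}
-- A is fibrant iff every map into A extends along trivial cofibrations.  Products, coproducts
-- and exponentials exist in 𝒞 (the slice over 1 is cartesian closed, coproducts are pushouts
-- under 0), and they are fibrant when their factors are: 0 and coproducts by (iii),
-- products by extending componentwise, and B^A by extending the transpose X × A → B along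
-- l × A, which is a trivial cofibration because it is a pullback of the trivial cofibration l
-- along the fibration Y × A → Y (right properness, and cofibrations are the monos).  So a
-- universal object of the full subcategory is a retract of the corresponding (fibrant)
-- universal object of 𝒞, hence universal in 𝒞 itself.
module Submission where

open import Level using (Level; _⊔_)
open import Data.Product using (_×_; Σ-syntax; _,_; proj₁; proj₂)
open import Relation.Binary.PropositionalEquality using (_≡_; refl; sym; trans; cong; cong₂; subst; module ≡-Reasoning)
open import Defs

module CategoryLemmas {o ℓ : Level} (𝒟 : Category o ℓ) where
  open Category 𝒟
  open Constructions 𝒟
  open ≡-Reasoning

  insertˡ : ∀ {A B C} {r : Hom B A} {s : Hom A B} → r ∘ s ≡ id →
            (h : Hom C A) → h ≡ r ∘ (s ∘ h)
  insertˡ {r = r} {s} rs h = begin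
    h             ≡⟨ sym identityˡ ⟩
    id ∘ h        ≡⟨ cong (_∘ h) (sym rs) ⟩
    (r ∘ s) ∘ h   ≡⟨ assoc ⟩
    r ∘ (s ∘ h)   ∎

  insertʳ : ∀ {A B C} {r : Hom B A} {s : Hom A B} → r ∘ s ≡ id →
            (h : Hom A C) → h ≡ (h ∘ r) ∘ s
  insertʳ {r = r} {s} rs h = begin
    h             ≡⟨ sym identityʳ ⟩
    h ∘ id        ≡⟨ cong (h ∘_) (sym rs) ⟩
    h ∘ (r ∘ s)   ≡⟨ sym assoc ⟩
    (h ∘ r) ∘ s   ∎

  pullˡ : ∀ {W X Y Z} {a : Hom Y Z} {b : Hom X Y} {c : Hom X Z} {k : Hom W X} →
          a ∘ b ≡ c → a ∘ (b ∘ k) ≡ c ∘ k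
  pullˡ {k = k} e = trans (sym assoc) (cong (_∘ k) e)

  pullʳ : ∀ {W X Y Z} {a : Hom X Y} {b : Hom W X} {c : Hom W Y} {k : Hom Y Z} →
          a ∘ b ≡ c → (k ∘ a) ∘ b ≡ k ∘ c
  pullʳ {k = k} e = trans assoc (cong (k ∘_) e)

  terminal-unique : ∀ {T X} → IsTerminal T → (g h : Hom X T) → g ≡ h
  terminal-unique {X = X} isTerminal g h =
    trans (proj₂ (isTerminal X) g) (sym (proj₂ (isTerminal X) h))

  initial-unique : ∀ {I X} → IsInitial I → (g h : Hom I X) → g ≡ h
  initial-unique {X = X} isInitial g h =
    trans (proj₂ (isInitial X) g) (sym (proj₂ (isInitial X) h))

  module Product {A B P : Obj} {π₁ : Hom P A} {π₂ : Hom P B} (isProduct : IsProduct π₁ π₂) where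
    ⟨_,_⟩ : ∀ {X} → Hom X A → Hom X B → Hom X P
    ⟨ f , g ⟩ = proj₁ (isProduct f g)

    project₁ : ∀ {X} {f : Hom X A} {g : Hom X B} → π₁ ∘ ⟨ f , g ⟩ ≡ f
    project₁ {f = f} {g} = proj₁ (proj₁ (proj₂ (isProduct f g)))

    project₂ : ∀ {X} {f : Hom X A} {g : Hom X B} → π₂ ∘ ⟨ f , g ⟩ ≡ g
    project₂ {f = f} {g} = proj₂ (proj₁ (proj₂ (isProduct f g)))

    unique : ∀ {X} {f : Hom X A} {g : Hom X B} (h : Hom X P) →
             π₁ ∘ h ≡ f → π₂ ∘ h ≡ g → h ≡ ⟨ f , g ⟩
    unique {f = f} {g} h e₁ e₂ = proj₂ (proj₂ (isProduct f g)) h (e₁ , e₂)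

    jointly-monic : ∀ {X} {h k : Hom X P} → π₁ ∘ h ≡ π₁ ∘ k → π₂ ∘ h ≡ π₂ ∘ k → h ≡ k
    jointly-monic {h = h} {k} e₁ e₂ = trans (unique h e₁ e₂) (sym (unique k refl refl))

    ⟨⟩∘ : ∀ {X Y} {f : Hom Y A} {g : Hom Y B} {h : Hom X Y} →
          ⟨ f , g ⟩ ∘ h ≡ ⟨ f ∘ h , g ∘ h ⟩
    ⟨⟩∘ {f = f} {g} {h} = unique (⟨ f , g ⟩ ∘ h)
      (trans (sym assoc) (cong (_∘ h) project₁))
      (trans (sym assoc) (cong (_∘ h) project₂))

    ⟨id∘π₁,π₂⟩ : ⟨ id ∘ π₁ , π₂ ⟩ ≡ id
    ⟨id∘π₁,π₂⟩ = sym (unique id (trans identityʳ (sym identityˡ)) identityʳ)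

  module Coproduct {A B S : Obj} {i₁ : Hom A S} {i₂ : Hom B S} (isCoproduct : IsCoproduct i₁ i₂) where
    [_,_] : ∀ {X} → Hom A X → Hom B X → Hom S X
    [ f , g ] = proj₁ (isCoproduct f g)

    inject₁ : ∀ {X} {f : Hom A X} {g : Hom B X} → [ f , g ] ∘ i₁ ≡ f
    inject₁ {f = f} {g} = proj₁ (proj₁ (proj₂ (isCoproduct f g)))

    inject₂ : ∀ {X} {f : Hom A X} {g : Hom B X} → [ f , g ] ∘ i₂ ≡ g
    inject₂ {f = f} {g} = proj₂ (proj₁ (proj₂ (isCoproduct f g)))

    unique : ∀ {X} {f : Hom A X} {g : Hom B X} (h : Hom S X) →
             h ∘ i₁ ≡ f → h ∘ i₂ ≡ g → h ≡ [ f , g ]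
    unique {f = f} {g} h e₁ e₂ = proj₂ (proj₂ (isCoproduct f g)) h (e₁ , e₂)

    jointly-epic : ∀ {X} {h k : Hom S X} → h ∘ i₁ ≡ k ∘ i₁ → h ∘ i₂ ≡ k ∘ i₂ → h ≡ k
    jointly-epic {h = h} {k} e₁ e₂ = trans (unique h e₁ e₂) (sym (unique k refl refl))

  module Exponential {A B E P : Obj} {π₁ : Hom P E} {π₂ : Hom P A} {ev : Hom P B}
                     (isExponential : IsExponential π₁ π₂ ev) where
    open IsExponential isExponential using (isProduct) public
    open Product isProduct public

    module _ {X Q : Obj} {q₁ : Hom Q X} {q₂ : Hom Q A} (isProductQ : IsProduct q₁ q₂) where
      private
        universal = IsExponential.curry-unique isExponential q₁ q₂ isProductQ

      curry : Hom Q B → Hom X E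
      curry f = proj₁ (universal f)

      curry-β : ∀ {f} → ev ∘ ⟨ curry f ∘ q₁ , q₂ ⟩ ≡ f
      curry-β {f} = proj₁ (proj₂ (universal f))

      curry-η : ∀ {f} {g : Hom X E} → ev ∘ ⟨ g ∘ q₁ , q₂ ⟩ ≡ f → g ≡ curry f
      curry-η {f} {g} = proj₂ (proj₂ (universal f)) g

      transpose-injective : ∀ {g g′ : Hom X E} →
                            ev ∘ ⟨ g ∘ q₁ , q₂ ⟩ ≡ ev ∘ ⟨ g′ ∘ q₁ , q₂ ⟩ → g ≡ g′
      transpose-injective e = trans (curry-η e) (sym (curry-η refl))

    curry-id : ∀ {g : Hom E E} → ev ∘ ⟨ g ∘ π₁ , π₂ ⟩ ≡ ev → g ≡ id
    curry-id e = transpose-injective isProduct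
      (trans e (sym (trans (cong (ev ∘_) ⟨id∘π₁,π₂⟩) identityʳ)))

  terminal-retract : ∀ {T T′} → IsTerminal T → (s : Hom T′ T) (r : Hom T T′) →
                     r ∘ s ≡ id → IsTerminal T′
  terminal-retract isTerminal s r rs X = r ∘ proj₁ (isTerminal X) , λ g →
    trans (insertˡ rs g) (cong (r ∘_) (proj₂ (isTerminal X) (s ∘ g)))

  initial-retract : ∀ {I I′} → IsInitial I → (s : Hom I′ I) (r : Hom I I′) →
                    r ∘ s ≡ id → IsInitial I′
  initial-retract isInitial s r rs X = proj₁ (isInitial X) ∘ s , λ g →
    trans (insertʳ rs g) (cong (_∘ s) (proj₂ (isInitial X) (g ∘ r)))

  product-retract : ∀ {A B P Q} {π₁ : Hom P A} {π₂ : Hom P B} {q₁ : Hom Q A} {q₂ : Hom Q B} →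
                    (isProductQ : IsProduct q₁ q₂) (r : Hom Q P) →
                    π₁ ∘ r ≡ q₁ → π₂ ∘ r ≡ q₂ → r ∘ Product.⟨_,_⟩ isProductQ π₁ π₂ ≡ id →
                    IsProduct π₁ π₂
  product-retract isProductQ r e₁ e₂ rs f g =
    r ∘ ⟨ f , g ⟩ , (trans (pullˡ e₁) project₁ , trans (pullˡ e₂) project₂) ,
    λ h (h₁ , h₂) → trans (insertˡ rs h)
      (cong (r ∘_) (unique (⟨ _ , _ ⟩ ∘ h) (trans (pullˡ project₁) h₁) (trans (pullˡ project₂) h₂)))
    where open Product isProductQ

  coproduct-retract : ∀ {A B S T} {i₁ : Hom A S} {i₂ : Hom B S} {j₁ : Hom A T} {j₂ : Hom B T} →
                      (isCoproductT : IsCoproduct j₁ j₂) (s : Hom S T) →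
                      s ∘ i₁ ≡ j₁ → s ∘ i₂ ≡ j₂ → Coproduct.[_,_] isCoproductT i₁ i₂ ∘ s ≡ id →
                      IsCoproduct i₁ i₂
  coproduct-retract isCoproductT s e₁ e₂ rs f g =
    [ f , g ] ∘ s , (trans (pullʳ e₁) inject₁ , trans (pullʳ e₂) inject₂) ,
    λ h (h₁ , h₂) → trans (insertʳ rs h)
      (cong (_∘ s) (unique (h ∘ [ _ , _ ]) (trans (pullʳ inject₁) h₁) (trans (pullʳ inject₂) h₂)))
    where open Coproduct isCoproductT

  module _ {A E E′ P P′} {π₁ : Hom P E} {π₂ : Hom P A} {π₁′ : Hom P′ E′} {π₂′ : Hom P′ A}
           (isProduct : IsProduct π₁ π₂) (isProduct′ : IsProduct π₁′ π₂′) where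
    private
      module P = Product isProduct
      module P′ = Product isProduct′

    first∘⟨⟩ : ∀ {Z} {a : Hom E′ E} {b : Hom Z E′} {c : Hom Z A} →
               P.⟨ a ∘ π₁′ , π₂′ ⟩ ∘ P′.⟨ b , c ⟩ ≡ P.⟨ a ∘ b , c ⟩
    first∘⟨⟩ = trans P.⟨⟩∘ (cong₂ P.⟨_,_⟩ (pullʳ P′.project₁) P′.project₂)

    ev∘first : ∀ {B} {ev : Hom P B} {ev′ : Hom P′ B} {a : Hom E′ E} →
               ev ∘ P.⟨ a ∘ π₁′ , π₂′ ⟩ ≡ ev′ →
               ∀ {Z W} {b : Hom W E′} {q : Hom Z W} {c : Hom Z A} →
               ev ∘ P.⟨ (a ∘ b) ∘ q , c ⟩ ≡ ev′ ∘ P′.⟨ b ∘ q , c ⟩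
    ev∘first {ev = ev} e {c = c} =
      trans (cong (λ x → ev ∘ P.⟨ x , c ⟩) assoc) (trans (cong (ev ∘_) (sym first∘⟨⟩)) (pullˡ e))

  exponential-retract : ∀ {A B E E′ P P′} {π₁ : Hom P E} {π₂ : Hom P A} {ev : Hom P B}
                          {π₁′ : Hom P′ E′} {π₂′ : Hom P′ A} {ev′ : Hom P′ B} →
                        (isExponential : IsExponential π₁ π₂ ev) (isProduct′ : IsProduct π₁′ π₂′)
                        (r : Hom E E′) (s : Hom E′ E) → r ∘ s ≡ id →
                        ev′ ∘ Product.⟨_,_⟩ isProduct′ (r ∘ π₁) π₂ ≡ ev →
                        ev ∘ Product.⟨_,_⟩ (IsExponential.isProduct isExponential) (s ∘ π₁′) π₂′ ≡ ev′ →
                        IsExponential π₁′ π₂′ ev′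
  exponential-retract isExponential isProduct′ r s rs r-ev s-ev = record
    { isProduct    = isProduct′
    ; curry-unique = λ q₁ q₂ isProductQ f →
        r ∘ curry isProductQ f ,
        trans (ev∘first isProduct′ isProduct r-ev) (curry-β isProductQ) ,
        λ y e → trans (insertˡ rs y)
          (cong (r ∘_) (curry-η isProductQ (trans (ev∘first isProduct isProduct′ s-ev) e)))
    }
    where open Exponential isExponential

  module _ {A B C P} {f : Hom A C} {g : Hom B C} {p₁ : Hom P A} {p₂ : Hom P B}
           (isPullback : IsPullback f g p₁ p₂) where
    private
      commutes : f ∘ p₁ ≡ g ∘ p₂
      commutes = proj₁ isPullback

      commutes∘ : ∀ {X} (x : Hom X P) → f ∘ (p₁ ∘ x) ≡ g ∘ (p₂ ∘ x)
      commutes∘ x = trans (pullˡ commutes) assoc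

    pullback-jointly-monic : ∀ {X} {a b : Hom X P} → p₁ ∘ a ≡ p₁ ∘ b → p₂ ∘ a ≡ p₂ ∘ b → a ≡ b
    pullback-jointly-monic {a = a} {b} e₁ e₂ =
      trans (proj₂ (proj₂ mediator) a (e₁ , e₂)) (sym (proj₂ (proj₂ mediator) b (refl , refl)))
      where mediator = proj₂ isPullback (p₁ ∘ b) (p₂ ∘ b) (commutes∘ b)

    pullback-mono : Mono f → Mono p₂
    pullback-mono mono a b e = pullback-jointly-monic
      (mono (p₁ ∘ a) (p₁ ∘ b) (begin
        f ∘ (p₁ ∘ a)   ≡⟨ commutes∘ a ⟩
        g ∘ (p₂ ∘ a)   ≡⟨ cong (g ∘_) e ⟩
        g ∘ (p₂ ∘ b)   ≡⟨ sym (commutes∘ b) ⟩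
        f ∘ (p₁ ∘ b)   ∎))
      e

    pullback-of-product : ∀ {D} {g′ : Hom B D} → IsProduct g g′ → IsProduct p₁ (g′ ∘ p₂)
    pullback-of-product {g′ = g′} isProduct h k =
      proj₁ mediator ,
      (proj₁ (proj₁ (proj₂ mediator)) , trans (pullʳ (proj₂ (proj₁ (proj₂ mediator)))) project₂) ,
      λ y (y₁ , y₂) → proj₂ (proj₂ mediator) y
        (y₁ , unique (p₂ ∘ y) (trans (sym (commutes∘ y)) (cong (f ∘_) y₁)) (trans (sym assoc) y₂))
      where
        open Product isProduct
        mediator = proj₂ isPullback h ⟨ f ∘ h , k ⟩ (sym project₁)

  pushout-under-initial : ∀ {I A B S} {f : Hom I A} {g : Hom I B} {q₁ : Hom A S} {q₂ : Hom B S} →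
                          IsInitial I → IsPushout f g q₁ q₂ → IsCoproduct q₁ q₂
  pushout-under-initial isInitial (_ , universal) h k =
    universal h k (initial-unique isInitial _ _)

module SliceOverTerminal {o ℓ : Level} (𝒟 : Category o ℓ) {T : Category.Obj 𝒟}
                         (isTerminal : Constructions.IsTerminal 𝒟 T) where
  open Category 𝒟
  open Constructions 𝒟
  open CategoryLemmas 𝒟 using (terminal-unique)
  open SliceHom

  private
    module 𝒮 = Constructions (Slice 𝒟 T)

    over : Obj → Σ[ A ∈ Obj ] Hom A T
    over X = X , proj₁ (isTerminal X)

    ↑ : ∀ {a b : Σ[ A ∈ Obj ] Hom A T} → Hom (proj₁ a) (proj₁ b) → SliceHom 𝒟 T a b
    ↑ f = sliceHom f (terminal-unique isTerminal _ _)

    hom-injective : ∀ {a b} {f g : SliceHom 𝒟 T a b} → hom f ≡ hom g → f ≡ g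
    hom-injective {f = sliceHom h _} {g = sliceHom .h _} refl = refl

  slice-product⇒product : ∀ {a b p} {π₁ : SliceHom 𝒟 T p a} {π₂ : SliceHom 𝒟 T p b} →
                          𝒮.IsProduct π₁ π₂ → IsProduct (hom π₁) (hom π₂)
  slice-product⇒product isProduct {X} f g =
    hom (proj₁ u) , (cong hom (proj₁ (proj₁ (proj₂ u))) , cong hom (proj₂ (proj₁ (proj₂ u)))) ,
    λ y (e₁ , e₂) → cong hom (proj₂ (proj₂ u) (↑ y) (hom-injective e₁ , hom-injective e₂))
    where u = isProduct {over X} (↑ f) (↑ g)

  product⇒slice-product : ∀ {A B Q} {q₁ : Hom Q A} {q₂ : Hom Q B} → IsProduct q₁ q₂ →
                          ∀ {a b q} → 𝒮.IsProduct {A , a} {B , b} {Q , q} (↑ q₁) (↑ q₂)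
  product⇒slice-product isProduct f g =
    ↑ (proj₁ u) , (hom-injective (proj₁ (proj₁ (proj₂ u))) , hom-injective (proj₂ (proj₁ (proj₂ u)))) ,
    λ y (e₁ , e₂) → hom-injective (proj₂ (proj₂ u) (hom y) (cong hom e₁ , cong hom e₂))
    where u = isProduct (hom f) (hom g)

  slice-exponential⇒exponential : ∀ {a b e p} {π₁ : SliceHom 𝒟 T p e} {π₂ : SliceHom 𝒟 T p a}
                                    {ev : SliceHom 𝒟 T p b} →
                                  𝒮.IsExponential π₁ π₂ ev → IsExponential (hom π₁) (hom π₂) (hom ev)
  slice-exponential⇒exponential {a} {e = e} {p} {π₁} {π₂} isExponential = record
    { isProduct    = slice-product⇒product {e} {a} {p} {π₁} {π₂} (𝒮.IsExponential.isProduct isExponential)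
    ; curry-unique = λ {X} {Q} q₁ q₂ isProductQ f →
        let u = 𝒮.IsExponential.curry-unique isExponential {over X} {over Q}
                  (↑ q₁) (↑ q₂) (product⇒slice-product isProductQ) (↑ f)
        in hom (proj₁ u) , cong hom (proj₁ (proj₂ u)) ,
           λ y e → cong hom (proj₂ (proj₂ u) (↑ y) (hom-injective e))
    }

  slice-products⇒products : 𝒮.HasBinaryProducts → HasBinaryProducts
  slice-products⇒products products A B =
    let (p , π₁ , π₂ , isProduct) = products (over A) (over B)
    in proj₁ p , hom π₁ , hom π₂ , slice-product⇒product {over A} {over B} {p} {π₁} {π₂} isProduct

  slice-exponentials⇒exponentials : 𝒮.HasExponentials → HasExponentials
  slice-exponentials⇒exponentials exponentials A B =
    let ((E , _) , (P , _) , π₁ , π₂ , ev , isExponential) = exponentials (over A) (over B)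
    in E , P , hom π₁ , hom π₂ , hom ev , slice-exponential⇒exponential isExponential

module FibrantObjects {o ℓ p : Level} {𝒞 : Category o ℓ} (M : ModelCategory 𝒞 p) where
  open Category 𝒞
  open ModelCategory M
  open Constructions 𝒞
  open CategoryLemmas 𝒞

  𝟙-terminal : IsTerminal 𝟙
  𝟙-terminal = proj₂ (FinitelyComplete.terminal finitelyComplete)

  !-unique : ∀ {X} (g h : Hom X 𝟙) → g ≡ h
  !-unique = terminal-unique 𝟙-terminal

  ExtendsAlongTrivialCofibrations : Obj → Set (o ⊔ ℓ ⊔ p)
  ExtendsAlongTrivialCofibrations A =
    ∀ {X Y} (l : Hom X Y) → C l → W l → (u : Hom X A) → Σ[ d ∈ Hom Y A ] (d ∘ l ≡ u)

  fibrant⇒extends : ∀ {A} → Fibrant A → ExtendsAlongTrivialCofibrations A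
  fibrant⇒extends {A} fibA l cof-l we-l u =
    let (d , d∘l≡u , _) = IsWFS.L⇒⧄R trivCof-fib (cof-l , we-l) fibA u (! _) (!-unique _ _)
    in d , d∘l≡u

  extends⇒fibrant : ∀ {A} → ExtendsAlongTrivialCofibrations A → Fibrant A
  extends⇒fibrant extends = IsWFS.L⧄⇒R trivCof-fib λ (cof-l , we-l) u _ _ →
    let (d , d∘l≡u) = extends _ cof-l we-l u
    in d , d∘l≡u , !-unique _ _

  fibrant-𝟙 : Fibrant 𝟙
  fibrant-𝟙 = extends⇒fibrant λ _ _ _ _ → ! _ , !-unique _ _

  fibrant-product : ∀ {A B P} {π₁ : Hom P A} {π₂ : Hom P B} →
                    IsProduct π₁ π₂ → Fibrant A → Fibrant B → Fibrant P
  fibrant-product {π₁ = π₁} {π₂} isProduct fibA fibB = extends⇒fibrant λ l cof-l we-l u →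
    let (d₁ , d₁∘l≡π₁∘u) = fibrant⇒extends fibA l cof-l we-l (π₁ ∘ u)
        (d₂ , d₂∘l≡π₂∘u) = fibrant⇒extends fibB l cof-l we-l (π₂ ∘ u)
    in ⟨ d₁ , d₂ ⟩ , jointly-monic (trans (pullˡ project₁) d₁∘l≡π₁∘u)
                                   (trans (pullˡ project₂) d₂∘l≡π₂∘u)
    where open Product isProduct

  π₁-fibration : ∀ {A B P} {π₁ : Hom P A} {π₂ : Hom P B} →
                 IsProduct π₁ π₂ → Fibrant B → F π₁
  π₁-fibration {π₂ = π₂} isProduct fibB = IsWFS.L⧄⇒R trivCof-fib λ (cof-l , we-l) u v π₁∘u≡v∘l →
    let (d , d∘l≡π₂∘u) = fibrant⇒extends fibB _ cof-l we-l (π₂ ∘ u)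
    in ⟨ v , d ⟩ , jointly-monic (trans (pullˡ project₁) (sym π₁∘u≡v∘l))
                                 (trans (pullˡ project₂) d∘l≡π₂∘u) ,
       project₁
    where open Product isProduct

module SuitableModelCategory {o ℓ p : Level} {𝒞 : Category o ℓ} {M : ModelCategory 𝒞 p}
                             (suitable : Suitable 𝒞 M) where
  open Category 𝒞
  open ModelCategory M
  open Suitable suitable
  open Constructions 𝒞
  open CategoryLemmas 𝒞
  open FibrantObjects M

  private
    sliceOver𝟙-cartesianClosed : Constructions.CartesianClosed (Slice 𝒞 𝟙)
    sliceOver𝟙-cartesianClosed = proj₂ lcc 𝟙

  open SliceOverTerminal 𝒞 𝟙-terminal

  products : HasBinaryProducts
  products = slice-products⇒products
    (Constructions.CartesianClosed.products sliceOver𝟙-cartesianClosed)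

  exponentials : HasExponentials
  exponentials = slice-exponentials⇒exponentials
    (Constructions.CartesianClosed.exponentials sliceOver𝟙-cartesianClosed)

  𝟘 : Obj
  𝟘 = proj₁ (FinitelyCocomplete.initial finitelyCocomplete)

  𝟘-initial : IsInitial 𝟘
  𝟘-initial = proj₂ (FinitelyCocomplete.initial finitelyCocomplete)

  coproducts : HasBinaryCoproducts
  coproducts A B =
    let (S , i₁ , i₂ , isPushout) = FinitelyCocomplete.pushout finitelyCocomplete
                                      (proj₁ (𝟘-initial A)) (proj₁ (𝟘-initial B))
    in S , i₁ , i₂ , pushout-under-initial 𝟘-initial isPushout

  fibrant-𝟘 : Fibrant 𝟘
  fibrant-𝟘 = subst F (!-unique _ _) (initial-fib 𝟘-initial 𝟙)

  fibrant-coproduct : ∀ {A B S} {i₁ : Hom A S} {i₂ : Hom B S} →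
                      IsCoproduct i₁ i₂ → Fibrant A → Fibrant B → Fibrant S
  fibrant-coproduct isCoproduct fibA fibB = subst F (!-unique _ _) (copair-fib isCoproduct fibA fibB)

  private
    module 𝔽 = Constructions (Fib M)
    module 𝔽-lemmas = CategoryLemmas (Fib M)

  fib-terminal⇒terminal : ∀ (T : Category.Obj (Fib M)) → 𝔽.IsTerminal T → IsTerminal (proj₁ T)
  fib-terminal⇒terminal T isTerminal =
    terminal-retract 𝟙-terminal (! (proj₁ T)) (proj₁ (isTerminal (𝟙 , fibrant-𝟙)))
      (𝔽-lemmas.terminal-unique {T} {T} isTerminal _ _)

  fib-initial⇒initial : ∀ (I : Category.Obj (Fib M)) → 𝔽.IsInitial I → IsInitial (proj₁ I)
  fib-initial⇒initial I isInitial =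
    initial-retract 𝟘-initial (proj₁ (isInitial (𝟘 , fibrant-𝟘))) (proj₁ (𝟘-initial (proj₁ I)))
      (𝔽-lemmas.initial-unique {I} {I} isInitial _ _)

  fib-product⇒product : ∀ {A B P : Category.Obj (Fib M)}
                            (π₁ : Hom (proj₁ P) (proj₁ A)) (π₂ : Hom (proj₁ P) (proj₁ B)) →
                          𝔽.IsProduct {A} {B} {P} π₁ π₂ → IsProduct π₁ π₂
  fib-product⇒product {A} {B} {P} π₁ π₂ isFibProduct =
    let (Q , q₁ , q₂ , isProductQ) = products (proj₁ A) (proj₁ B)
        Q̂ = Q , fibrant-product isProductQ (proj₂ A) (proj₂ B)
        open Product isProductQ
        module P = 𝔽-lemmas.Product {A} {B} {P} {π₁} {π₂} (λ {Z} → isFibProduct {Z})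
    in product-retract isProductQ (P.⟨_,_⟩ {Q̂} q₁ q₂) (P.project₁ {Q̂}) (P.project₂ {Q̂})
         (P.jointly-monic {P} (trans (pullˡ (P.project₁ {Q̂})) (trans project₁ (sym identityʳ)))
                              (trans (pullˡ (P.project₂ {Q̂})) (trans project₂ (sym identityʳ))))

  fib-coproduct⇒coproduct : ∀ {A B S : Category.Obj (Fib M)}
                              (i₁ : Hom (proj₁ A) (proj₁ S)) (i₂ : Hom (proj₁ B) (proj₁ S)) →
                            𝔽.IsCoproduct {A} {B} {S} i₁ i₂ → IsCoproduct i₁ i₂
  fib-coproduct⇒coproduct {A} {B} {S} i₁ i₂ isFibCoproduct =
    let (T , j₁ , j₂ , isCoproductT) = coproducts (proj₁ A) (proj₁ B)
        T̂ = T , fibrant-coproduct isCoproductT (proj₂ A) (proj₂ B)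
        open Coproduct isCoproductT
        module S = 𝔽-lemmas.Coproduct {A} {B} {S} {i₁} {i₂} (λ {Z} → isFibCoproduct {Z})
    in coproduct-retract isCoproductT (S.[_,_] {T̂} j₁ j₂) (S.inject₁ {T̂}) (S.inject₂ {T̂})
         (S.jointly-epic {S} (trans (pullʳ (S.inject₁ {T̂})) (trans inject₁ (sym identityˡ)))
                             (trans (pullʳ (S.inject₂ {T̂})) (trans inject₂ (sym identityˡ))))

  module _ {A B E P} {π₁ : Hom P E} {π₂ : Hom P A} {ev : Hom P B}
           (isExponential : IsExponential π₁ π₂ ev) (fibA : Fibrant A) (fibB : Fibrant B) where
    open Exponential isExponential

    extend-along-pullback : ∀ {X Y Q Z} {l : Hom X Y} {q₁ : Hom Q Y} {q₂ : Hom Q A}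
                              {p₁ : Hom Z X} {p₂ : Hom Z Q} →
                            IsProduct q₁ q₂ → IsPullback l q₁ p₁ p₂ → C l → W l →
                            (u : Hom X E) → Σ[ d ∈ Hom Y E ] (d ∘ l ≡ u)
    extend-along-pullback {Y = Y} {Q} {l = l} {q₁} {q₂} {p₁} {p₂} isProductQ isPullback cof-l we-l u =
      curry isProductQ d′ , transpose-injective isProductZ (begin
        ev ∘ ⟨ (curry isProductQ d′ ∘ l) ∘ p₁ , q₂ ∘ p₂ ⟩   ≡⟨ cong (ev ∘_) l×A-square ⟩
        ev ∘ (⟨ curry isProductQ d′ ∘ q₁ , q₂ ⟩ ∘ p₂)       ≡⟨ pullˡ (curry-β isProductQ) ⟩
        d′ ∘ p₂                                              ≡⟨ d′∘p₂≡ū ⟩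
        ev ∘ ⟨ u ∘ p₁ , q₂ ∘ p₂ ⟩                           ∎)
      where
        open ≡-Reasoning
        isProductZ : IsProduct p₁ (q₂ ∘ p₂)
        isProductZ = pullback-of-product isPullback isProductQ

        cof-p₂ : C p₂
        cof-p₂ = mono⇒cof (pullback-mono isPullback (cof⇒mono cof-l))

        we-p₂ : W p₂
        we-p₂ = rightProper l q₁ p₁ p₂ isPullback we-l (π₁-fibration isProductQ fibA)

        extension : Σ[ d′ ∈ Hom Q B ] (d′ ∘ p₂ ≡ ev ∘ ⟨ u ∘ p₁ , q₂ ∘ p₂ ⟩)
        extension = fibrant⇒extends fibB p₂ cof-p₂ we-p₂ (ev ∘ ⟨ u ∘ p₁ , q₂ ∘ p₂ ⟩)

        d′ : Hom Q B
        d′ = proj₁ extension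

        d′∘p₂≡ū : d′ ∘ p₂ ≡ ev ∘ ⟨ u ∘ p₁ , q₂ ∘ p₂ ⟩
        d′∘p₂≡ū = proj₂ extension

        l×A-square : ∀ {g : Hom Y E} → ⟨ (g ∘ l) ∘ p₁ , q₂ ∘ p₂ ⟩ ≡ ⟨ g ∘ q₁ , q₂ ⟩ ∘ p₂
        l×A-square {g} = sym (trans ⟨⟩∘ (cong ⟨_, q₂ ∘ p₂ ⟩
          (trans assoc (trans (cong (g ∘_) (sym (proj₁ isPullback))) (sym assoc)))))

    fibrant-exponential : Fibrant E
    fibrant-exponential = extends⇒fibrant λ l cof-l we-l u →
      let (_ , q₁ , q₂ , isProductQ) = products _ A
          (_ , _ , _ , isPullback) = FinitelyComplete.pullback finitelyComplete l q₁
      in extend-along-pullback isProductQ isPullback cof-l we-l u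

    fib-exponential⇒exponential : ∀ {E′ P′ : Category.Obj (Fib M)}
                                    {π₁′ : Hom (proj₁ P′) (proj₁ E′)} {π₂′ : Hom (proj₁ P′) A}
                                    {ev′ : Hom (proj₁ P′) B} →
                                  𝔽.IsExponential {A , fibA} {B , fibB} {E′} {P′} π₁′ π₂′ ev′ →
                                  IsExponential π₁′ π₂′ ev′
    fib-exponential⇒exponential {E′} {P′} {π₁′} {π₂′} {ev′} isFibExponential =
      exponential-retract isExponential isProduct′ r s rs r-ev s-ev
      where
        Ê P̂ : Category.Obj (Fib M)
        Ê = E , fibrant-exponential
        P̂ = P , fibrant-product isProduct fibrant-exponential fibA

        module P′ = 𝔽-lemmas.Exponential isFibExponential

        isProduct′ : IsProduct π₁′ π₂′
        isProduct′ = fib-product⇒product {E′} {A , fibA} {P′} π₁′ π₂′ (λ {Z} → P′.isProduct {Z})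

        module 𝒞P′ = Product isProduct′

        fib-pair≡pair : ∀ {Z} {a : Hom (proj₁ Z) (proj₁ E′)} {b : Hom (proj₁ Z) A} →
                        P′.⟨_,_⟩ {Z} a b ≡ 𝒞P′.⟨ a , b ⟩
        fib-pair≡pair {Z} = 𝒞P′.unique _ (P′.project₁ {Z}) (P′.project₂ {Z})

        r : Hom E (proj₁ E′)
        r = P′.curry {Ê} {P̂} (λ f g → isProduct f g) ev

        s : Hom (proj₁ E′) E
        s = curry isProduct′ ev′

        r-ev : ev′ ∘ 𝒞P′.⟨ r ∘ π₁ , π₂ ⟩ ≡ ev
        r-ev = trans (cong (ev′ ∘_) (sym (fib-pair≡pair {P̂})))
                     (P′.curry-β {Ê} {P̂} (λ f g → isProduct f g))

        s-ev : ev ∘ ⟨ s ∘ π₁′ , π₂′ ⟩ ≡ ev′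
        s-ev = curry-β isProduct′

        rs : r ∘ s ≡ id
        rs = P′.curry-id (trans (cong (ev′ ∘_) (fib-pair≡pair {P′}))
                                (trans (ev∘first isProduct′ isProduct r-ev) s-ev))

  fib-bicartesianClosed : 𝔽.BicartesianClosed
  fib-bicartesianClosed = record
    { terminal     = (𝟙 , fibrant-𝟙) , λ _ → ! _ , proj₂ (𝟙-terminal _)
    ; products     = λ A B →
        let (P , π₁ , π₂ , isProduct) = products (proj₁ A) (proj₁ B)
        in (P , fibrant-product isProduct (proj₂ A) (proj₂ B)) , π₁ , π₂ , λ f g → isProduct f g
    ; initial      = (𝟘 , fibrant-𝟘) , λ _ → 𝟘-initial _
    ; coproducts   = λ A B →
        let (S , i₁ , i₂ , isCoproduct) = coproducts (proj₁ A) (proj₁ B)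
        in (S , fibrant-coproduct isCoproduct (proj₂ A) (proj₂ B)) , i₁ , i₂ , λ f g → isCoproduct f g
    ; exponentials = λ A B →
        let (E , P , π₁ , π₂ , ev , isExponential) = exponentials (proj₁ A) (proj₁ B)
            open IsExponential isExponential
            fibE = fibrant-exponential isExponential (proj₂ A) (proj₂ B)
        in (E , fibE) , (P , fibrant-product isProduct fibE (proj₂ A)) , π₁ , π₂ , ev , record
             { isProduct    = λ f g → isProduct f g
             ; curry-unique = λ {X} {Q} q₁ q₂ isFibProductQ →
                 curry-unique q₁ q₂ (fib-product⇒product {X} {A} {Q} q₁ q₂ (λ {Z} → isFibProductQ {Z}))
             }
    }

  inclusion-bicartesianClosed : InclusionBicartesianClosed M
  inclusion-bicartesianClosed = record
    { pres-terminal    = fib-terminal⇒terminal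
    ; pres-initial     = fib-initial⇒initial
    ; pres-product     = λ {A} {B} {P} π₁ π₂ isFibProduct →
        fib-product⇒product {A} {B} {P} π₁ π₂ (λ {Z} → isFibProduct {Z})
    ; pres-coproduct   = λ {A} {B} {S} i₁ i₂ isFibCoproduct →
        fib-coproduct⇒coproduct {A} {B} {S} i₁ i₂ (λ {Z} → isFibCoproduct {Z})
    ; pres-exponential = λ {A} {B} _ _ _ →
        let (_ , _ , _ , _ , _ , isExponential) = exponentials (proj₁ A) (proj₁ B)
        in fib-exponential⇒exponential isExponential (proj₂ A) (proj₂ B)
    }

proposition3p2p5 : ∀ {o ℓ p : Level} (𝒞 : Category o ℓ) (M : ModelCategory 𝒞 p) →
    Suitable 𝒞 M →
    Constructions.BicartesianClosed (Fib M) × InclusionBicartesianClosed M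
proposition3p2p5 𝒞 M suitable = fib-bicartesianClosed , inclusion-bicartesianClosed
  where open SuitableModelCategory suitable
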